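{- For every pattern $p$ over a finite alphabet $\Sigma$ and every $n\in\mathbb{N}$, $D_p(n)\le D_p(n+1)$.
   Context: For a pattern $p$ and $n\in\mathbb{N}$, $D_p(n)$ is the deterministic decision tree complexity of deciding whether $p$ occurs as a contiguous substring of an unknown string $s\in\Sigma^n$: the minimum, over all deterministic adaptive algorithms that query characters of $s$ and correctly output whether $p$ is a substring of $s$, of the maximum over $s\in\Sigma^n$ of the number of characters queried. -}

module Defs where

open import Data.Nat using (ℕ; zero; suc; _≤_)
open import Data.Fin using (Fin)
open import Data.Bool using (Bool; true)
open import Data.List using (List; _++_)
open import Data.Vec using (Vec; lookup; toList)
open import Data.Product using (∃₂)
open import Relation.Binary.PropositionalEquality using (_≡_)
open import Function.Bundles using (_⇔_)

-- Alphabet Σ = Fin k (any finite alphabet, up to renaming of letters).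
-- Pattern: a word p ∈ Σ*.  Unknown string: s ∈ Σⁿ, i.e. Vec (Fin k) n.

Occurs : ∀ {k n} → List (Fin k) → Vec (Fin k) n → Set
Occurs p s = ∃₂ λ u v → toList s ≡ u ++ (p ++ v)

-- Deterministic adaptive query algorithm on strings of length n over Fin k:
-- either output an answer, or query position i and branch on the character read.
data DTree (k n : ℕ) : Set where
  leaf  : Bool → DTree k n
  query : Fin n → (Fin k → DTree k n) → DTree k n

eval : ∀ {k n} → DTree k n → Vec (Fin k) n → Bool
eval (leaf b)    s = b
eval (query i f) s = eval (f (lookup s i)) s

queries : ∀ {k n} → DTree k n → Vec (Fin k) n → ℕ
queries (leaf b)    s = 0
queries (query i f) s = suc (queries (f (lookup s i)) s)

Correct : ∀ {k n} → List (Fin k) → DTree k n → Set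
Correct p T = ∀ s → (eval T s ≡ true) ⇔ Occurs p s

CostAtMost : ∀ {k n} → DTree k n → ℕ → Set
CostAtMost T d = ∀ s → queries T s ≤ d

-- "D_p(n) ≤ d": some correct algorithm uses at most d queries on every input
DAtMost : ∀ {k} → List (Fin k) → ℕ → ℕ → Set
DAtMost {k} p n d = ∃₂ λ (T : DTree k n) (_ : Correct p T) → CostAtMost T d

-- D_p(m) ≤ D_p(n), where D_p(n) = min{ d | DAtMost p n d } (a min over a
-- nonempty set of naturals):  D_p(m) ≤ D_p(n)  iff  every d ≥ D_p(n) is ≥ D_p(m).
D≤D : ∀ {k} → List (Fin k) → ℕ → ℕ → Set
D≤D p m n = ∀ d → DAtMost p n d → DAtMost p m d

-- A query algorithm for strings of length n + 1 can be run on strings of length n by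
-- pretending the input is prefixed with a fixed letter c: queries to position 0 are
-- answered with c, the others are shifted by one. If c differs from the first letter of
-- p, prefixing c neither creates nor destroys an occurrence of p, so the simulation
-- stays correct and never asks more queries. When no such c exists, p is empty or the
-- alphabet has a single letter; then the answer does not depend on the input at all and
-- a tree with no query decides it.
module Submission where

open import Defs
open import Data.Nat using (ℕ; zero; suc; _≤_; z≤n; s≤s)
open import Data.Nat.Properties using (m≤n⇒m≤1+n; ≤-trans)
open import Data.Fin using (Fin; zero; suc; _≟_)
open import Data.List using (List; []; _∷_; _++_)
open import Data.List.Properties using (∷-injectiveˡ; ∷-injectiveʳ)
open import Data.List.Relation.Binary.Infix.Heterogeneous
  using (Infix; View; MkView; toView; fromView)
open import Data.List.Relation.Binary.Infix.Heterogeneous.Properties using (infix?)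
open import Data.List.Relation.Binary.Pointwise using (Pointwise-≡⇒≡; ≡⇒Pointwise-≡)
open import Data.Vec using (Vec; []; _∷_; lookup; toList; replicate)
open import Data.Bool using (Bool; true; false)
open import Data.Product using (∃₂; _,_)
open import Data.Empty using (⊥-elim)
open import Function using (_∘_)
open import Function.Bundles using (_⇔_; mk⇔; Equivalence)
open import Relation.Nullary using (Dec; yes; no)
import Relation.Nullary.Decidable as Dec
open import Relation.Binary.PropositionalEquality
  using (_≡_; _≢_; refl; sym; trans; cong; subst)

module _ {A : Set} where

  Infix⇔∃++ : {p xs : List A} → Infix _≡_ p xs ⇔ ∃₂ λ u v → xs ≡ u ++ (p ++ v)
  Infix⇔∃++ {p} = mk⇔ (fromView′ ∘ toView) λ (u , v , eq) →
    subst (Infix _≡_ p) (sym eq) (fromView (MkView u (≡⇒Pointwise-≡ refl) v))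
    where
    fromView′ : ∀ {xs} → View _≡_ p xs → ∃₂ λ u v → xs ≡ u ++ (p ++ v)
    fromView′ (MkView u p≈ v) = u , v , cong (λ q → u ++ (q ++ v)) (sym (Pointwise-≡⇒≡ p≈))

Occurs? : ∀ {k n} (p : List (Fin k)) (s : Vec (Fin k) n) → Dec (Occurs p s)
Occurs? p s = Dec.map Infix⇔∃++ (infix? _≟_ p (toList s))

Occurs-[] : ∀ {k n} (s : Vec (Fin k) n) → Occurs [] s
Occurs-[] s = [] , toList s , refl

Occurs-∷⇔ : ∀ {k n} {c x : Fin k} {p : List (Fin k)} → c ≢ x → (s : Vec (Fin k) n) →
            Occurs (x ∷ p) (c ∷ s) ⇔ Occurs (x ∷ p) s
Occurs-∷⇔ {c = c} c≢x s = mk⇔ drop-head (λ (u , v , eq) → c ∷ u , v , cong (c ∷_) eq)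
  where
  drop-head : Occurs _ (c ∷ s) → Occurs _ s
  drop-head ([]    , v , eq) = ⊥-elim (c≢x (∷-injectiveˡ eq))
  drop-head (_ ∷ u , v , eq) = u , v , ∷-injectiveʳ eq

Vec-Fin1-unique : ∀ {n} (s : Vec (Fin 1) n) → s ≡ replicate n zero
Vec-Fin1-unique [] = refl
Vec-Fin1-unique (zero ∷ s) = cong (zero ∷_) (Vec-Fin1-unique s)

fixHead : ∀ {k n} → Fin k → DTree k (suc n) → DTree k n
fixHead c (leaf b)          = leaf b
fixHead c (query zero f)    = fixHead c (f c)
fixHead c (query (suc i) f) = query i (fixHead c ∘ f)

eval-fixHead : ∀ {k n} c (T : DTree k (suc n)) (s : Vec (Fin k) n) →
               eval (fixHead c T) s ≡ eval T (c ∷ s)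
eval-fixHead c (leaf b)          s = refl
eval-fixHead c (query zero f)    s = eval-fixHead c (f c) s
eval-fixHead c (query (suc i) f) s = eval-fixHead c (f (lookup s i)) s

queries-fixHead : ∀ {k n} c (T : DTree k (suc n)) (s : Vec (Fin k) n) →
                  queries (fixHead c T) s ≤ queries T (c ∷ s)
queries-fixHead c (leaf b)          s = z≤n
queries-fixHead c (query zero f)    s = m≤n⇒m≤1+n (queries-fixHead c (f c) s)
queries-fixHead c (query (suc i) f) s = s≤s (queries-fixHead c (f (lookup s i)) s)

DAtMost-leaf : ∀ {k} (p : List (Fin k)) n (b : Bool) →
               (∀ s → (b ≡ true) ⇔ Occurs p s) → ∀ d → DAtMost p n d
DAtMost-leaf p n b correct d = leaf b , correct , λ _ → z≤n

D≤D-suc-by-head : ∀ {k} (p : List (Fin k)) (c : Fin k) →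
                  (∀ {n} (s : Vec (Fin k) n) → Occurs p (c ∷ s) ⇔ Occurs p s) →
                  ∀ n → D≤D p n (suc n)
D≤D-suc-by-head p c head-irrelevant n d (T , correct , cost) =
  fixHead c T , correct′ , λ s → ≤-trans (queries-fixHead c T s) (cost (c ∷ s))
  where
  open Equivalence
  correct′ : Correct p (fixHead c T)
  correct′ s = mk⇔
    (λ e → to (head-irrelevant s) (to (correct (c ∷ s)) (trans (sym (eval-fixHead c T s)) e)))
    (λ o → trans (eval-fixHead c T s) (from (correct (c ∷ s)) (from (head-irrelevant s) o)))

DAtMost-unary : (p : List (Fin 1)) (n d : ℕ) → DAtMost p n d
DAtMost-unary p n with Occurs? p (replicate n zero)
... | yes o = DAtMost-leaf p n true λ s →
  mk⇔ (λ _ → subst (Occurs p) (sym (Vec-Fin1-unique s)) o) (λ _ → refl)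
... | no ¬o = DAtMost-leaf p n false λ s →
  mk⇔ (λ ()) (λ o → ⊥-elim (¬o (subst (Occurs p) (Vec-Fin1-unique s) o)))

other : ∀ {k} → Fin (suc (suc k)) → Fin (suc (suc k))
other zero    = suc zero
other (suc _) = zero

other≢ : ∀ {k} (x : Fin (suc (suc k))) → other x ≢ x
other≢ zero    ()
other≢ (suc _) ()

proposition1 : (k : ℕ) (p : List (Fin k)) (n : ℕ) → D≤D p n (suc n)
proposition1 k             []      n d _ =
  DAtMost-leaf [] n true (λ s → mk⇔ (λ _ → Occurs-[] s) (λ _ → refl)) d
proposition1 zero          (() ∷ _)
proposition1 (suc zero)    p       n d _ = DAtMost-unary p n d
proposition1 (suc (suc k)) (x ∷ p) n   =
  D≤D-suc-by-head (x ∷ p) (other x) (Occurs-∷⇔ (other≢ x)) n
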